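{- Let $\mathbb{F}_q$ be a finite field with $q\equiv 1\pmod{3}$, let $s=(q-1)/3$, let $\mu_3=\{u\in\mathbb{F}_q^*: u^3=1\}$, and let $K=\{z\in\mathbb{F}_q^*: z^s=1\}$. Let $r$ be a positive integer and let $c\colon\mu_3\to\mathbb{F}_q^*$ be a function. Define $f\colon\mathbb{F}_q\to\mathbb{F}_q$ by $f(0)=0$ and $f(x)=x^r\,c(x^s)$ for $x\in\mathbb{F}_q^*$ (note $x^s\in\mu_3$ for $x\in\mathbb{F}_q^*$), and let $F(x)=f(x)+x$. Assume: (G1) $\gcd(r,s)=1$, $\gcd(r,3)=1$, and $c(u)^s=1$ for all $u\in\mu_3$; (G2) for each $u\in\mu_3$ and each $t\in\mathbb{F}_q^*$ with $t^s=u$, setting $\beta_u:=c(u)\,t^{r-1}$, the map $\varphi_u\colon K\to\mathbb{F}_q^*$, $z\mapsto z\,(1+\beta_u z^{r-1})$, is injective; (G3) for each $u\in\mu_3$ (and $t$, $\beta_u$ as in (G2)), the value $(1+\beta_u z^{r-1})^s$ is independent of the choice of $z\in K$ and lies in $\mu_3$; denote it $v(u)$; (G4) the map $\bar\psi\colon\mu_3\to\mu_3$, $\bar\psi(u)=u\cdot v(u)$, is a permutation of $\mu_3$. Then $f$ is a complete permutation polynomial of $\mathbb{F}_q$, i.e., both $f$ and $F$ are bijections of $\mathbb{F}_q$.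
   Context: A complete permutation polynomial of $\mathbb{F}_q$ is a polynomial (equivalently, a function $\mathbb{F}_q\to\mathbb{F}_q$) $f$ such that both $x\mapsto f(x)$ and $x\mapsto f(x)+x$ are permutations of $\mathbb{F}_q$. The function $f$ above agrees on $\mathbb{F}_q$ with a polynomial of the form $X^r h(X^s)$, where $h$ is a polynomial interpolating $c$ on $\mu_3$. -}

module Defs where

open import Level using (Level; suc; _⊔_)
open import Data.Nat as ℕ using (ℕ)
open import Data.Fin using (Fin)
open import Data.Product using (Σ; _×_)
open import Relation.Nullary using (¬_; Dec; yes; no)
open import Relation.Binary.PropositionalEquality using (_≡_)
open import Algebra.Structures using (IsCommutativeRing)
open import Function.Bundles using (_↔_)

record FiniteField (a : Level) : Set (suc a) where
  infixl 7 _*_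
  infixl 6 _+_
  field
    Carrier : Set a
    _+_ _*_ : Carrier → Carrier → Carrier
    -_      : Carrier → Carrier
    0# 1#   : Carrier
    isCommutativeRing : IsCommutativeRing _≡_ _+_ _*_ -_ 0# 1#
    0≢1     : ¬ (0# ≡ 1#)
    inverse : ∀ x → ¬ (x ≡ 0#) → Σ Carrier (λ y → x * y ≡ 1#)
    _≟_     : (x y : Carrier) → Dec (x ≡ y)
    size    : ℕ
    enum    : Fin size ↔ Carrier

  _^_ : Carrier → ℕ → Carrier
  x ^ ℕ.zero  = 1#
  x ^ ℕ.suc n = x * (x ^ n)

  Inμ₃ : Carrier → Set a
  Inμ₃ u = ¬ (u ≡ 0#) × (u ^ 3 ≡ 1#)

  InK : ℕ → Carrier → Set a
  InK s z = ¬ (z ≡ 0#) × (z ^ s ≡ 1#)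

sOf : ℕ → ℕ
sOf q = (q ℕ.∸ 1) ℕ./ 3

module _ {a : Level} (F : FiniteField a) where
  open FiniteField F

  -- f(0) = 0, f(x) = x^r c(x^s) for x ≠ 0   (c only evaluated on μ₃)
  fMap : (r : ℕ) → (c : Carrier → Carrier) → Carrier → Carrier
  fMap r c x with x ≟ 0#
  ... | yes _ = 0#
  ... | no  _ = (x ^ r) * c (x ^ sOf size)

  FMap : (r : ℕ) → (c : Carrier → Carrier) → Carrier → Carrier
  FMap r c x = fMap r c x + x

  β : (r : ℕ) → (c : Carrier → Carrier) → (u t : Carrier) → Carrier
  β r c u t = c u * (t ^ (r ℕ.∸ 1))

  φ : (r : ℕ) → (b z : Carrier) → Carrier
  φ r b z = z * (1# + b * (z ^ (r ℕ.∸ 1)))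

-- Both f and F fix 0 and map F_q^* into itself, so on the finite field it suffices to
-- show that they are injective on F_q^*; and x^s lies in μ₃ for x ≠ 0 by Fermat.
-- For f: c(u)^s = 1 gives f(x)^s = (x^s)^r, and r is invertible modulo 3, so f(x) = f(y)
-- forces x^s = y^s, hence c(x^s) = c(y^s), hence x^r = y^r; with x^s = y^s and
-- gcd(r, s) = 1 this gives x = y.
-- For F: writing u = x^s, every y with y^s = u is x z for some z ∈ K, and
-- F(x z) = x φ_u(z). By (G3), F(x)^s = u v(u), so F(x) = F(y) forces x^s = y^s by (G4);
-- then x φ_u(1) = F(x) = F(y) = x φ_u(z), and (G2) gives z = 1.
module Submission where

open import Defs
open import Level using (Level)
open import Data.Nat as ℕ using (ℕ; zero; suc; _%_; _∸_; _/_; NonZero)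
open import Data.Nat.DivMod using (m≡m%n+[m/n]*n; m*n/n≡m)
open import Data.Nat.GCD using (gcd; module Bézout)
open import Data.Nat.Coprimality using (gcd≡1⇒coprime; coprime-Bézout)
import Data.Nat.Properties as ℕ
open import Data.Fin as Fin using (Fin; punchIn; punchOut)
open import Data.Fin.Properties using (any?; punchInᵢ≢i; punchOut-injective; <⇒notInjective)
open import Data.Fin.Permutation using (Permutation)
open import Data.Product using (Σ; _×_; _,_; proj₁; proj₂)
open import Data.Vec.Functional using (removeAt)
open import Data.Empty using (⊥-elim)
open import Relation.Nullary using (¬_; yes; no; contradiction)
open import Relation.Binary.PropositionalEquality
open import Function.Base using (_∘_)
open import Function.Bundles using (Inverse; _↔_; mk↔ₛ′)
open import Function.Definitions using (Injective; Surjective; Bijective)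
open import Function.Construct.Composition using (_↔-∘_)
open import Function.Construct.Symmetry using (↔-sym)
open import Algebra.Bundles using (CommutativeRing)
import Algebra.Properties.CommutativeSemiring.Exp as SemiringExp
import Algebra.Properties.CommutativeMonoid.Sum as Sum
import Algebra.Solver.Ring.NaturalCoefficients.Default as Solver

pred-/-*-cancel : ∀ n d .{{_ : NonZero d}} → n % d ≡ 1 → (n ∸ 1) / d ℕ.* d ≡ n ∸ 1
pred-/-*-cancel n d n%d≡1 = begin
  (n ∸ 1) / d ℕ.* d      ≡⟨ cong (λ m → m / d ℕ.* d) n∸1≡[n/d]*d ⟩
  n / d ℕ.* d / d ℕ.* d  ≡⟨ cong (ℕ._* d) (m*n/n≡m (n / d) d) ⟩
  n / d ℕ.* d            ≡⟨ sym n∸1≡[n/d]*d ⟩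
  n ∸ 1                  ∎
  where
  open ≡-Reasoning
  n∸1≡[n/d]*d : n ∸ 1 ≡ n / d ℕ.* d
  n∸1≡[n/d]*d = cong (_∸ 1) (trans (m≡m%n+[m/n]*n n d) (cong (ℕ._+ n / d ℕ.* d) n%d≡1))

Fin-irrelevant : ∀ {n} → n ∸ 1 ≡ 0 → (i j : Fin n) → i ≡ j
Fin-irrelevant {suc zero}    _  Fin.zero Fin.zero = refl
Fin-irrelevant {suc (suc n)} ()

Fin-injective⇒surjective : ∀ {n} (h : Fin n → Fin n) → Injective _≡_ _≡_ h → Surjective _≡_ _≡_ h
Fin-injective⇒surjective {suc m} h h-injective y with any? (λ i → h i Fin.≟ y)
... | yes (i , hi≡y) = i , λ { refl → hi≡y }
... | no ∄i = ⊥-elim (<⇒notInjective (ℕ.n<1+n m) h′-injective)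
  where
  y≢h : ∀ i → y ≢ h i
  y≢h i y≡hi = ∄i (i , sym y≡hi)
  h′ : Fin (suc m) → Fin m
  h′ i = punchOut (y≢h i)
  h′-injective : Injective _≡_ _≡_ h′
  h′-injective {i} {j} = h-injective ∘ punchOut-injective (y≢h i) (y≢h j)

finite-injective⇒bijective : ∀ {a n} {A : Set a} → Fin n ↔ A →
                             (h : A → A) → Injective _≡_ _≡_ h → Bijective _≡_ _≡_ h
finite-injective⇒bijective e h h-injective = h-injective , h-surjective
  where
  open Inverse e using (to; from; strictlyInverseˡ; strictlyInverseʳ)
  from-injective : Injective _≡_ _≡_ from
  from-injective {x} {y} eq = trans (sym (strictlyInverseˡ x)) (trans (cong to eq) (strictlyInverseˡ y))
  to-injective : Injective _≡_ _≡_ to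
  to-injective {i} {j} eq = trans (sym (strictlyInverseʳ i)) (trans (cong from eq) (strictlyInverseʳ j))
  h′ : Fin _ → Fin _
  h′ = from ∘ h ∘ to
  h-surjective : Surjective _≡_ _≡_ h
  h-surjective y with Fin-injective⇒surjective h′ (to-injective ∘ h-injective ∘ from-injective) (from y)
  ... | i , h′i≡y = to i , λ { refl → trans (sym (strictlyInverseˡ _)) (trans (cong to (h′i≡y refl)) (strictlyInverseˡ y)) }

module _ {a : Level} (𝔽 : FiniteField a) where
  open FiniteField 𝔽
  open ≡-Reasoning

  ring : CommutativeRing a a
  ring = record { isCommutativeRing = isCommutativeRing }

  open CommutativeRing ring
    using (*-comm; *-assoc; *-identityˡ; *-identityʳ; zeroˡ; zeroʳ; +-identityˡ;
           commutativeSemiring; *-commutativeMonoid)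
  private
    module Exp = SemiringExp commutativeSemiring
    module Product = Sum *-commutativeMonoid
  open Solver commutativeSemiring using (solve; _:=_; _:+_; _:*_; con)

  ^≡Exp^ : ∀ x n → x ^ n ≡ x Exp.^ n
  ^≡Exp^ x zero    = refl
  ^≡Exp^ x (suc n) = cong (x *_) (^≡Exp^ x n)

  ^-assocʳ : ∀ x m n → (x ^ m) ^ n ≡ x ^ (m ℕ.* n)
  ^-assocʳ x m n rewrite ^≡Exp^ (x ^ m) n | ^≡Exp^ x m | ^≡Exp^ x (m ℕ.* n) = Exp.^-assocʳ x m n

  ^-distrib-* : ∀ x y n → (x * y) ^ n ≡ x ^ n * y ^ n
  ^-distrib-* x y n rewrite ^≡Exp^ (x * y) n | ^≡Exp^ x n | ^≡Exp^ y n = Exp.^-distrib-* x y n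

  ^-*-cong : ∀ {x y} k m → x ^ m ≡ y ^ m → x ^ (k ℕ.* m) ≡ y ^ (k ℕ.* m)
  ^-*-cong {x} {y} k m xᵐ≡yᵐ = begin
    x ^ (k ℕ.* m)  ≡⟨ cong (x ^_) (ℕ.*-comm k m) ⟩
    x ^ (m ℕ.* k)  ≡⟨ ^-assocʳ x m k ⟨
    (x ^ m) ^ k    ≡⟨ cong (_^ k) xᵐ≡yᵐ ⟩
    (y ^ m) ^ k    ≡⟨ ^-assocʳ y m k ⟩
    y ^ (m ℕ.* k)  ≡⟨ cong (y ^_) (ℕ.*-comm m k) ⟩
    y ^ (k ℕ.* m)  ∎

  1^n≡1 : ∀ n → 1# ^ n ≡ 1#
  1^n≡1 zero    = refl
  1^n≡1 (suc n) = trans (*-identityˡ _) (1^n≡1 n)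

  0^n≡0 : ∀ n .{{_ : NonZero n}} → 0# ^ n ≡ 0#
  0^n≡0 (suc n) = zeroˡ _

  ^-pred : ∀ x n .{{_ : NonZero n}} → x ^ n ≡ x * x ^ (n ∸ 1)
  ^-pred x (suc n) = refl

  inv : ∀ {x} → x ≢ 0# → Carrier
  inv {x} x≢0 = proj₁ (inverse x x≢0)

  *-inv-cancel : ∀ {x} (x≢0 : x ≢ 0#) y → x * (inv x≢0 * y) ≡ y
  *-inv-cancel {x} x≢0 y = begin
    x * (inv x≢0 * y)  ≡⟨ *-assoc x _ y ⟨
    x * inv x≢0 * y    ≡⟨ cong (_* y) (proj₂ (inverse x x≢0)) ⟩
    1# * y             ≡⟨ *-identityˡ y ⟩
    y                  ∎

  inv-*-cancel : ∀ {x} (x≢0 : x ≢ 0#) y → inv x≢0 * (x * y) ≡ y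
  inv-*-cancel {x} x≢0 y = begin
    inv x≢0 * (x * y)  ≡⟨ *-assoc _ x y ⟨
    inv x≢0 * x * y    ≡⟨ cong (_* y) (*-comm _ x) ⟩
    x * inv x≢0 * y    ≡⟨ cong (_* y) (proj₂ (inverse x x≢0)) ⟩
    1# * y             ≡⟨ *-identityˡ y ⟩
    y                  ∎

  *-cancelˡ : ∀ {x y z} → x ≢ 0# → x * y ≡ x * z → y ≡ z
  *-cancelˡ {x} {y} {z} x≢0 eq =
    trans (sym (inv-*-cancel x≢0 y)) (trans (cong (inv x≢0 *_) eq) (inv-*-cancel x≢0 z))

  *-cancelʳ : ∀ {x y z} → x ≢ 0# → y * x ≡ z * x → y ≡ z
  *-cancelʳ {x} {y} {z} x≢0 eq = *-cancelˡ x≢0 (trans (*-comm x y) (trans eq (*-comm z x)))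

  x*y≢0 : ∀ {x y} → x ≢ 0# → y ≢ 0# → x * y ≢ 0#
  x*y≢0 {x} x≢0 y≢0 xy≡0 = y≢0 (*-cancelˡ x≢0 (trans xy≡0 (sym (zeroʳ x))))

  x^n≢0 : ∀ {x} n → x ≢ 0# → x ^ n ≢ 0#
  x^n≢0 zero    x≢0 1≡0 = 0≢1 (sym 1≡0)
  x^n≢0 (suc n) x≢0     = x*y≢0 x≢0 (x^n≢0 n x≢0)

  ^-injective-Bézout : ∀ {x y} m n j l → 1 ℕ.+ l ℕ.* n ≡ j ℕ.* m → x ≢ 0# →
                       x ^ m ≡ y ^ m → x ^ n ≡ y ^ n → x ≡ y
  ^-injective-Bézout {x} {y} m n j l eq x≢0 xᵐ≡yᵐ xⁿ≡yⁿ = *-cancelʳ (x^n≢0 (l ℕ.* n) x≢0) (begin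
    x * x ^ (l ℕ.* n)  ≡⟨ cong (x ^_) eq ⟩
    x ^ (j ℕ.* m)      ≡⟨ ^-*-cong j m xᵐ≡yᵐ ⟩
    y ^ (j ℕ.* m)      ≡⟨ cong (y ^_) eq ⟨
    y * y ^ (l ℕ.* n)  ≡⟨ cong (y *_) (^-*-cong l n xⁿ≡yⁿ) ⟨
    y * x ^ (l ℕ.* n)  ∎)

  ^-injective-coprime : ∀ m n {x y} → gcd m n ≡ 1 → x ≢ 0# → x ^ m ≡ y ^ m → x ^ n ≡ y ^ n → x ≡ y
  ^-injective-coprime m n gcd≡1 x≢0 xᵐ≡yᵐ xⁿ≡yⁿ with coprime-Bézout (gcd≡1⇒coprime gcd≡1)
  ... | Bézout.+- j l eq = ^-injective-Bézout m n j l eq x≢0 xᵐ≡yᵐ xⁿ≡yⁿ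
  ... | Bézout.-+ l j eq = ^-injective-Bézout n m j l eq x≢0 xⁿ≡yⁿ xᵐ≡yᵐ

  same-power-coset : ∀ {x y} s → x ≢ 0# → y ≢ 0# → x ^ s ≡ y ^ s → Σ Carrier λ z → InK s z × x * z ≡ y
  same-power-coset {x} {y} s x≢0 y≢0 xˢ≡yˢ = z , (z≢0 , zˢ≡1) , *-inv-cancel x≢0 y
    where
    z : Carrier
    z = inv x≢0 * y
    z≢0 : z ≢ 0#
    z≢0 z≡0 = y≢0 (trans (sym (*-inv-cancel x≢0 y)) (trans (cong (x *_) z≡0) (zeroʳ x)))
    zˢ≡1 : z ^ s ≡ 1#
    zˢ≡1 = *-cancelˡ (x^n≢0 s x≢0) (begin
      x ^ s * z ^ s  ≡⟨ ^-distrib-* x z s ⟨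
      (x * z) ^ s    ≡⟨ cong (_^ s) (*-inv-cancel x≢0 y) ⟩
      y ^ s          ≡⟨ xˢ≡yˢ ⟨
      x ^ s          ≡⟨ *-identityʳ _ ⟨
      x ^ s * 1#     ∎)

  units-injective⇒injective : (h : Carrier → Carrier) → h 0# ≡ 0# → (∀ {x} → x ≢ 0# → h x ≢ 0#) →
                              (∀ {x y} → x ≢ 0# → y ≢ 0# → h x ≡ h y → x ≡ y) → Injective _≡_ _≡_ h
  units-injective⇒injective h h0≡0 h≢0 h-injective {x} {y} hx≡hy with x ≟ 0# | y ≟ 0#
  ... | yes x≡0 | yes y≡0 = trans x≡0 (sym y≡0)
  ... | yes x≡0 | no  y≢0 = contradiction (trans (sym hx≡hy) (trans (cong h x≡0) h0≡0)) (h≢0 y≢0)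
  ... | no  x≢0 | yes y≡0 = contradiction (trans hx≡hy (trans (cong h y≡0) h0≡0)) (h≢0 x≢0)
  ... | no  x≢0 | no  y≢0 = h-injective x≢0 y≢0 hx≡hy

  ∏ : ∀ {n} → (Fin n → Carrier) → Carrier
  ∏ = Product.sum

  ∏-cong : ∀ {n} {s t : Fin n → Carrier} → (∀ i → s i ≡ t i) → ∏ s ≡ ∏ t
  ∏-cong = Product.sum-cong-≗

  ∏-const : ∀ {n x} {t : Fin n → Carrier} → (∀ j → t j ≡ x) → ∏ t ≡ x ^ n
  ∏-const {zero}  _    = refl
  ∏-const {suc n} t≡x = cong₂ _*_ (t≡x Fin.zero) (∏-const (t≡x ∘ Fin.suc))

  ∏-const-except : ∀ {n x} (t : Fin n → Carrier) i → t i ≡ 1# → (∀ j → j ≢ i → t j ≡ x) → ∏ t ≡ x ^ (n ∸ 1)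
  ∏-const-except {suc n} {x} t i tᵢ≡1 tⱼ≡x = begin
    ∏ t                     ≡⟨ Product.sum-remove t ⟩
    t i * ∏ (removeAt t i)  ≡⟨ cong₂ _*_ tᵢ≡1 (∏-const (λ j → tⱼ≡x (punchIn i j) (punchInᵢ≢i i j))) ⟩
    1# * x ^ n              ≡⟨ *-identityˡ _ ⟩
    x ^ n                   ∎

  ∏-≢0 : ∀ {n} (t : Fin n → Carrier) → (∀ i → t i ≢ 0#) → ∏ t ≢ 0#
  ∏-≢0 {zero}  t t≢0 1≡0 = 0≢1 (sym 1≡0)
  ∏-≢0 {suc n} t t≢0     = x*y≢0 (t≢0 Fin.zero) (∏-≢0 (t ∘ Fin.suc) (t≢0 ∘ Fin.suc))

  unit-part : Carrier → Carrier
  unit-part y with y ≟ 0#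
  ... | yes _ = 1#
  ... | no  _ = y

  unit-part-≢0 : ∀ y → unit-part y ≢ 0#
  unit-part-≢0 y with y ≟ 0#
  ... | yes _   = λ 1≡0 → 0≢1 (sym 1≡0)
  ... | no  y≢0 = y≢0

  open Inverse enum using (to; from; strictlyInverseˡ; strictlyInverseʳ)

  scaling : ∀ {x} → x ≢ 0# → Permutation size size
  scaling {x} x≢0 = ↔-sym enum ↔-∘ (mk↔ₛ′ (x *_) (inv x≢0 *_) (*-inv-cancel x≢0) (inv-*-cancel x≢0) ↔-∘ enum)

  -- Multiplying by x permutes the field; it multiplies unit-part y by x for each of the
  -- q - 1 nonzero y and leaves unit-part 0 = 1 alone.
  fermat : ∀ {x} → x ≢ 0# → x ^ (size ∸ 1) ≡ 1#
  fermat {x} x≢0 = sym (*-cancelʳ (∏-≢0 (unit-part ∘ to) (unit-part-≢0 ∘ to)) (begin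
    1# * P                                      ≡⟨ *-identityˡ P ⟩
    P                                           ≡⟨ Product.sum-permute (unit-part ∘ to) (scaling x≢0) ⟩
    ∏ (λ i → unit-part (to (from (x * to i))))  ≡⟨ ∏-cong (λ i → cong unit-part (strictlyInverseˡ (x * to i))) ⟩
    ∏ (λ i → unit-part (x * to i))              ≡⟨ ∏-cong (unit-part-scale ∘ to) ⟩
    ∏ (λ i → weight (to i) * unit-part (to i))  ≡⟨ Product.∑-distrib-+ (weight ∘ to) (unit-part ∘ to) ⟩
    ∏ (weight ∘ to) * P                         ≡⟨ cong (_* P) ∏weight ⟩
    x ^ (size ∸ 1) * P                          ∎))
    where
    P : Carrier
    P = ∏ (unit-part ∘ to)
    weight : Carrier → Carrier
    weight y with y ≟ 0#
    ... | yes _ = 1#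
    ... | no  _ = x
    unit-part-scale : ∀ y → unit-part (x * y) ≡ weight y * unit-part y
    unit-part-scale y with y ≟ 0# | (x * y) ≟ 0#
    ... | yes _   | yes _    = sym (*-identityˡ 1#)
    ... | yes y≡0 | no  xy≢0 = contradiction (trans (cong (x *_) y≡0) (zeroʳ x)) xy≢0
    ... | no  y≢0 | yes xy≡0 = contradiction xy≡0 (x*y≢0 x≢0 y≢0)
    ... | no  _   | no  _    = refl
    weight-0 : weight 0# ≡ 1#
    weight-0 with 0# ≟ 0#
    ... | yes _   = refl
    ... | no  0≢0 = contradiction refl 0≢0
    weight-≢0 : ∀ {y} → y ≢ 0# → weight y ≡ x
    weight-≢0 {y} y≢0 with y ≟ 0#
    ... | yes y≡0 = contradiction y≡0 y≢0
    ... | no  _   = refl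
    ∏weight : ∏ (weight ∘ to) ≡ x ^ (size ∸ 1)
    ∏weight = ∏-const-except (weight ∘ to) (from 0#) (trans (cong weight (strictlyInverseˡ 0#)) weight-0)
      (λ j j≢i → weight-≢0 (λ toj≡0 → j≢i (trans (sym (strictlyInverseʳ j)) (cong from toj≡0))))

  μ₃-^-injective : ∀ r {u w} → gcd r 3 ≡ 1 → Inμ₃ u → Inμ₃ w → u ^ r ≡ w ^ r → u ≡ w
  μ₃-^-injective r gcd[r,3]≡1 (u≢0 , u³≡1) (_ , w³≡1) uʳ≡wʳ =
    ^-injective-coprime r 3 gcd[r,3]≡1 u≢0 uʳ≡wʳ (trans u³≡1 (sym w³≡1))

  1∈K : ∀ s → InK s 1#
  1∈K s = (λ 1≡0 → 0≢1 (sym 1≡0)) , 1^n≡1 s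

  fMap-0 : ∀ r c → fMap 𝔽 r c 0# ≡ 0#
  fMap-0 r c with 0# ≟ 0#
  ... | yes _   = refl
  ... | no  0≢0 = contradiction refl 0≢0

  fMap-≢0 : ∀ r c {x} → x ≢ 0# → fMap 𝔽 r c x ≡ x ^ r * c (x ^ sOf size)
  fMap-≢0 r c {x} x≢0 with x ≟ 0#
  ... | yes x≡0 = contradiction x≡0 x≢0
  ... | no  _   = refl

  FMap-0 : ∀ r c → FMap 𝔽 r c 0# ≡ 0#
  FMap-0 r c = trans (cong (_+ 0#) (fMap-0 r c)) (+-identityˡ 0#)

  FMap-scale : ∀ r .{{_ : NonZero r}} c {x z} → x ≢ 0# → InK (sOf size) z →
               FMap 𝔽 r c (x * z) ≡ x * φ 𝔽 r (β 𝔽 r c (x ^ sOf size) x) z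
  FMap-scale r c {x} {z} x≢0 (z≢0 , zˢ≡1) = begin
    fMap 𝔽 r c (x * z) + x * z             ≡⟨ cong (_+ x * z) (fMap-≢0 r c (x*y≢0 x≢0 z≢0)) ⟩
    (x * z) ^ r * c ((x * z) ^ s) + x * z  ≡⟨ cong₂ (λ p u → p * c u + x * z) [xz]ʳ [xz]ˢ≡xˢ ⟩
    x * z * (X * Z) * c (x ^ s) + x * z    ≡⟨ regroup x z (c (x ^ s)) X Z ⟩
    x * (z * (1# + c (x ^ s) * X * Z))     ∎
    where
    s : ℕ
    s = sOf size
    X Z : Carrier
    X = x ^ (r ∸ 1)
    Z = z ^ (r ∸ 1)
    [xz]ʳ : (x * z) ^ r ≡ x * z * (X * Z)
    [xz]ʳ = trans (^-pred (x * z) r) (cong (x * z *_) (^-distrib-* x z (r ∸ 1)))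
    [xz]ˢ≡xˢ : (x * z) ^ s ≡ x ^ s
    [xz]ˢ≡xˢ = trans (^-distrib-* x z s) (trans (cong (x ^ s *_) zˢ≡1) (*-identityʳ _))
    regroup : ∀ x z C X Z → x * z * (X * Z) * C + x * z ≡ x * (z * (1# + C * X * Z))
    regroup = solve 5 (λ x z C X Z → x :* z :* (X :* Z) :* C :+ x :* z := x :* (z :* (con 1 :+ C :* X :* Z))) refl

  FMap-≡-φ1 : ∀ r .{{_ : NonZero r}} c {x} → x ≢ 0# → FMap 𝔽 r c x ≡ x * φ 𝔽 r (β 𝔽 r c (x ^ sOf size) x) 1#
  FMap-≡-φ1 r c {x} x≢0 = trans (cong (FMap 𝔽 r c) (sym (*-identityʳ x))) (FMap-scale r c x≢0 (1∈K (sOf size)))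

  module _ (q%3≡1 : size % 3 ≡ 1) where
    private
      s : ℕ
      s = sOf size

    s*3≡q∸1 : s ℕ.* 3 ≡ size ∸ 1
    s*3≡q∸1 = pred-/-*-cancel size 3 q%3≡1

    s-nonZero : NonZero s
    s-nonZero = ℕ.≢-nonZero s≢0
      where
      s≢0 : s ≢ 0
      s≢0 s≡0 = 0≢1 (begin
        0#               ≡⟨ strictlyInverseˡ 0# ⟨
        to (from 0#)     ≡⟨ cong to (Fin-irrelevant q∸1≡0 (from 0#) (from 1#)) ⟩
        to (from 1#)     ≡⟨ strictlyInverseˡ 1# ⟩
        1#               ∎)
        where
        q∸1≡0 : size ∸ 1 ≡ 0
        q∸1≡0 = trans (sym s*3≡q∸1) (cong (ℕ._* 3) s≡0)

    ^s∈μ₃ : ∀ {x} → x ≢ 0# → Inμ₃ (x ^ s)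
    ^s∈μ₃ {x} x≢0 = x^n≢0 s x≢0 , (begin
      (x ^ s) ^ 3     ≡⟨ ^-assocʳ x s 3 ⟩
      x ^ (s ℕ.* 3)   ≡⟨ cong (x ^_) s*3≡q∸1 ⟩
      x ^ (size ∸ 1)  ≡⟨ fermat x≢0 ⟩
      1#              ∎)

    module _ (r : ℕ) (c : Carrier → Carrier) (cˢ≡1 : ∀ u → Inμ₃ u → c u ^ s ≡ 1#) where

      fMap-^s : ∀ {x} → x ≢ 0# → fMap 𝔽 r c x ^ s ≡ (x ^ s) ^ r
      fMap-^s {x} x≢0 = begin
        fMap 𝔽 r c x ^ s              ≡⟨ cong (_^ s) (fMap-≢0 r c x≢0) ⟩
        (x ^ r * c (x ^ s)) ^ s       ≡⟨ ^-distrib-* (x ^ r) _ s ⟩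
        (x ^ r) ^ s * c (x ^ s) ^ s   ≡⟨ cong ((x ^ r) ^ s *_) (cˢ≡1 _ (^s∈μ₃ x≢0)) ⟩
        (x ^ r) ^ s * 1#              ≡⟨ *-identityʳ _ ⟩
        (x ^ r) ^ s                   ≡⟨ ^-assocʳ x r s ⟩
        x ^ (r ℕ.* s)                 ≡⟨ cong (x ^_) (ℕ.*-comm r s) ⟩
        x ^ (s ℕ.* r)                 ≡⟨ ^-assocʳ x s r ⟨
        (x ^ s) ^ r                   ∎

      fMap-injective : (∀ u → Inμ₃ u → c u ≢ 0#) → gcd r s ≡ 1 → gcd r 3 ≡ 1 → Injective _≡_ _≡_ (fMap 𝔽 r c)
      fMap-injective c≢0 gcd[r,s]≡1 gcd[r,3]≡1 = units-injective⇒injective (fMap 𝔽 r c) (fMap-0 r c) fx≢0 injective-on-units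
        where
        c[xˢ]≢0 : ∀ {x} → x ≢ 0# → c (x ^ s) ≢ 0#
        c[xˢ]≢0 x≢0 = c≢0 _ (^s∈μ₃ x≢0)
        fx≢0 : ∀ {x} → x ≢ 0# → fMap 𝔽 r c x ≢ 0#
        fx≢0 {x} x≢0 fx≡0 = x*y≢0 (x^n≢0 r x≢0) (c[xˢ]≢0 x≢0) (trans (sym (fMap-≢0 r c x≢0)) fx≡0)
        injective-on-units : ∀ {x y} → x ≢ 0# → y ≢ 0# → fMap 𝔽 r c x ≡ fMap 𝔽 r c y → x ≡ y
        injective-on-units {x} {y} x≢0 y≢0 fx≡fy = ^-injective-coprime r s gcd[r,s]≡1 x≢0 xʳ≡yʳ xˢ≡yˢ
          where
          xˢ≡yˢ : x ^ s ≡ y ^ s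
          xˢ≡yˢ = μ₃-^-injective r gcd[r,3]≡1 (^s∈μ₃ x≢0) (^s∈μ₃ y≢0)
                    (trans (sym (fMap-^s x≢0)) (trans (cong (_^ s) fx≡fy) (fMap-^s y≢0)))
          xʳ≡yʳ : x ^ r ≡ y ^ r
          xʳ≡yʳ = *-cancelʳ (c[xˢ]≢0 x≢0) (begin
            x ^ r * c (x ^ s)  ≡⟨ fMap-≢0 r c x≢0 ⟨
            fMap 𝔽 r c x       ≡⟨ fx≡fy ⟩
            fMap 𝔽 r c y       ≡⟨ fMap-≢0 r c y≢0 ⟩
            y ^ r * c (y ^ s)  ≡⟨ cong (λ u → y ^ r * c u) xˢ≡yˢ ⟨
            y ^ r * c (x ^ s)  ∎)

    module _ (r : ℕ) .{{_ : NonZero r}} (c v : Carrier → Carrier) (v∈μ₃ : ∀ u → Inμ₃ u → Inμ₃ (v u))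
             (v-spec : ∀ u t → Inμ₃ u → t ≢ 0# → t ^ s ≡ u →
                       ∀ z → InK s z → (1# + β 𝔽 r c u t * (z ^ (r ∸ 1))) ^ s ≡ v u) where

      FMap-^s : ∀ {x} → x ≢ 0# → FMap 𝔽 r c x ^ s ≡ x ^ s * v (x ^ s)
      FMap-^s {x} x≢0 = begin
        FMap 𝔽 r c x ^ s                       ≡⟨ cong (_^ s) (FMap-≡-φ1 r c x≢0) ⟩
        (x * φ 𝔽 r (β 𝔽 r c (x ^ s) x) 1#) ^ s  ≡⟨ ^-distrib-* x _ s ⟩
        x ^ s * φ 𝔽 r (β 𝔽 r c (x ^ s) x) 1# ^ s ≡⟨ cong (λ w → x ^ s * w ^ s) (*-identityˡ _) ⟩
        x ^ s * (1# + β 𝔽 r c (x ^ s) x * 1# ^ (r ∸ 1)) ^ s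
                                               ≡⟨ cong (x ^ s *_) (v-spec _ x (^s∈μ₃ x≢0) x≢0 refl 1# (1∈K s)) ⟩
        x ^ s * v (x ^ s)                      ∎

      FMap-≢0 : ∀ {x} → x ≢ 0# → FMap 𝔽 r c x ≢ 0#
      FMap-≢0 {x} x≢0 Fx≡0 = x*y≢0 (x^n≢0 s x≢0) (proj₁ (v∈μ₃ _ (^s∈μ₃ x≢0))) (begin
        x ^ s * v (x ^ s)  ≡⟨ FMap-^s x≢0 ⟨
        FMap 𝔽 r c x ^ s   ≡⟨ cong (_^ s) Fx≡0 ⟩
        0# ^ s             ≡⟨ 0^n≡0 s {{s-nonZero}} ⟩
        0#                 ∎)

      FMap-injective : (∀ u t → Inμ₃ u → t ≢ 0# → t ^ s ≡ u →
                          ∀ z w → InK s z → InK s w → φ 𝔽 r (β 𝔽 r c u t) z ≡ φ 𝔽 r (β 𝔽 r c u t) w → z ≡ w) →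
                       (∀ u w → Inμ₃ u → Inμ₃ w → u * v u ≡ w * v w → u ≡ w) →
                       Injective _≡_ _≡_ (FMap 𝔽 r c)
      FMap-injective φ-injective ψ̄-injective = units-injective⇒injective (FMap 𝔽 r c) (FMap-0 r c) FMap-≢0 injective-on-units
        where
        ^s-injective-on-units : ∀ {x y} → x ≢ 0# → y ≢ 0# → FMap 𝔽 r c x ≡ FMap 𝔽 r c y → x ^ s ≡ y ^ s
        ^s-injective-on-units {x} {y} x≢0 y≢0 Fx≡Fy = ψ̄-injective _ _ (^s∈μ₃ x≢0) (^s∈μ₃ y≢0) (begin
          x ^ s * v (x ^ s)  ≡⟨ FMap-^s x≢0 ⟨
          FMap 𝔽 r c x ^ s   ≡⟨ cong (_^ s) Fx≡Fy ⟩
          FMap 𝔽 r c y ^ s   ≡⟨ FMap-^s y≢0 ⟩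
          y ^ s * v (y ^ s)  ∎)
        injective-on-K-coset : ∀ {x z} → x ≢ 0# → InK s z → FMap 𝔽 r c x ≡ FMap 𝔽 r c (x * z) → 1# ≡ z
        injective-on-K-coset {x} {z} x≢0 z∈K Fx≡Fxz =
          φ-injective _ x (^s∈μ₃ x≢0) x≢0 refl 1# z (1∈K s) z∈K (*-cancelˡ x≢0 (begin
            x * φ 𝔽 r (β 𝔽 r c (x ^ s) x) 1#  ≡⟨ FMap-≡-φ1 r c x≢0 ⟨
            FMap 𝔽 r c x                      ≡⟨ Fx≡Fxz ⟩
            FMap 𝔽 r c (x * z)                ≡⟨ FMap-scale r c x≢0 z∈K ⟩
            x * φ 𝔽 r (β 𝔽 r c (x ^ s) x) z   ∎))
        injective-on-units : ∀ {x y} → x ≢ 0# → y ≢ 0# → FMap 𝔽 r c x ≡ FMap 𝔽 r c y → x ≡ y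
        injective-on-units {x} {y} x≢0 y≢0 Fx≡Fy with same-power-coset s x≢0 y≢0 (^s-injective-on-units x≢0 y≢0 Fx≡Fy)
        ... | z , z∈K , refl = trans (sym (*-identityʳ x)) (cong (x *_) (injective-on-K-coset x≢0 z∈K Fx≡Fy))

theorem4p1 : ∀ {a : Level} (𝔽 : FiniteField a) → let open FiniteField 𝔽 in let s = sOf size in
    size % 3 ≡ 1 →
    (r : ℕ) → NonZero r →
    (c : Carrier → Carrier) →
    (∀ u → Inμ₃ u → ¬ (c u ≡ 0#)) →
    gcd r s ≡ 1 → gcd r 3 ≡ 1 → (∀ u → Inμ₃ u → c u ^ s ≡ 1#) →
    (∀ u t → Inμ₃ u → ¬ (t ≡ 0#) → t ^ s ≡ u →
      ∀ z w → InK s z → InK s w → φ 𝔽 r (β 𝔽 r c u t) z ≡ φ 𝔽 r (β 𝔽 r c u t) w → z ≡ w) →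
    (v : Carrier → Carrier) →
    (∀ u → Inμ₃ u → Inμ₃ (v u)) →
    (∀ u t → Inμ₃ u → ¬ (t ≡ 0#) → t ^ s ≡ u →
      ∀ z → InK s z → (1# + β 𝔽 r c u t * (z ^ (r ∸ 1))) ^ s ≡ v u) →
    (∀ u w → Inμ₃ u → Inμ₃ w → u * v u ≡ w * v w → u ≡ w) →
    (∀ w → Inμ₃ w → Σ Carrier (λ u → Inμ₃ u × (u * v u ≡ w))) →
    Bijective _≡_ _≡_ (fMap 𝔽 r c) × Bijective _≡_ _≡_ (FMap 𝔽 r c)
theorem4p1 𝔽 q%3≡1 r r≢0 c c≢0 gcd[r,s]≡1 gcd[r,3]≡1 cˢ≡1 φ-injective v v∈μ₃ v-spec ψ̄-injective _ =
  finite-injective⇒bijective enum (fMap 𝔽 r c)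
    (fMap-injective 𝔽 q%3≡1 r c cˢ≡1 c≢0 gcd[r,s]≡1 gcd[r,3]≡1) ,
  finite-injective⇒bijective enum (FMap 𝔽 r c)
    (FMap-injective 𝔽 q%3≡1 r {{r≢0}} c v v∈μ₃ v-spec φ-injective ψ̄-injective)
  where open FiniteField 𝔽 using (enum)
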